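{- Let $n\ge 2$ and let $T=(V,E)$ be the path with $V=\{0,\dots,n\}$ and $E=\{\{i,i+1\}: 0\le i\le n-1\}$. Then $\mathrm{LMC}(T)$ equals the set of all $x\in\mathbb{R}^{\binom{V}{2}}$ satisfying $x_{0n}\le 1$; $x_{in}\le x_{i-1,n}$ for all $i\in\{1,\dots,n-1\}$; $x_{0i}\le x_{0,i+1}$ for all $i\in\{1,\dots,n-1\}$; $x_{i-1,i+1}\le x_{i-1,i}+x_{i,i+1}$ for all $i\in\{1,\dots,n-1\}$; $x_{j,k}+x_{j+1,k-1}\le x_{j+1,k}+x_{j,k-1}$ for all $j,k\in\{0,\dots,n\}$ with $j<k-2$.
   Context: Edges of $T$ are identified with pairs in $\binom{V}{2}$, and $x_{ij}$ with $i<j$ denotes the coordinate indexed by $\{i,j\}$. A decomposition of $T$ is a partition of $V$ each of whose blocks induces a connected subpath; its lifted multicut is the set of pairs $ab\in\binom{V}{2}$ with $a,b$ in distinct blocks. $\mathrm{LMC}(T)\subseteq\mathbb{R}^{\binom{V}{2}}$ is the convex hull of the characteristic vectors of these lifted multicuts over all decompositions of $T$.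
   Formalization: The points x are taken in ℚ^(V choose 2) instead of $\mathbb{R}^{\binom{V}{2}}$, and the convex hull LMC(T) is formed with rational weights. -}

module Defs where

open import Data.Nat as ℕ using (ℕ; zero; suc; _∸_)
open import Data.Fin as Fin using (Fin; fromℕ<)
open import Data.Fin.Properties as FinP using ()
open import Data.Nat.Properties as ℕP using ()
open import Data.Product using (Σ; Σ-syntax; _×_; _,_; proj₁; proj₂)
open import Data.List using (List; []; _∷_; foldr; map)
open import Data.List.Relation.Unary.All using (All)
open import Data.Rational using (ℚ; 0ℚ; 1ℚ; _+_; _*_; _≤_)
open import Relation.Binary.PropositionalEquality using (_≡_)
open import Relation.Nullary using (yes; no)

-- The path T on vertex set V = {0,…,n} is represented by V = Fin (suc n).
-- Coordinates of ℝ^(V choose 2): unordered pairs {i,j}, written (i , j , i<j).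
Pair : ℕ → Set
Pair n = Σ[ i ∈ Fin (suc n) ] Σ[ j ∈ Fin (suc n) ] (i Fin.< j)

Point : ℕ → Set
Point n = Pair n → ℚ

-- A partition of V is given by a block-labelling f : V → V (blocks = fibres of f).
-- Each block induces a connected subpath of T: whenever a < c < b and a, b are
-- in the same block, then c is in that block too.
IsDecomposition : (n : ℕ) → (Fin (suc n) → Fin (suc n)) → Set
IsDecomposition n f =
  ∀ (a b c : Fin (suc n)) → a Fin.< c → c Fin.< b → f a ≡ f b → f c ≡ f a

Decomposition : ℕ → Set
Decomposition n = Σ (Fin (suc n) → Fin (suc n)) (IsDecomposition n)

-- Characteristic vector of the lifted multicut of a decomposition:
-- pair ab gets 1 iff a and b lie in distinct blocks.
χ : {n : ℕ} → Decomposition n → Point n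
χ (f , _) (a , b , _) with f a Fin.≟ f b
... | yes _ = 0ℚ
... | no  _ = 1ℚ

sumℚ : List ℚ → ℚ
sumℚ = foldr _+_ 0ℚ

combo : {n : ℕ} → List (ℚ × Decomposition n) → Point n
combo ws p = sumℚ (map (λ w → proj₁ w * χ (proj₂ w) p) ws)

-- LMC(T): the convex hull of the characteristic vectors of lifted multicuts
-- (over ℚ).
InLMC : (n : ℕ) → Point n → Set
InLMC n x = Σ[ ws ∈ List (ℚ × Decomposition n) ]
  ( All (λ w → 0ℚ ≤ proj₁ w) ws
  × sumℚ (map proj₁ ws) ≡ 1ℚ
  × (∀ p → x p ≡ combo ws p) )

-- Coordinate access x_{ij} by natural-number indices (i < j ≤ n);
-- returns 0 outside that range (never used there in the statement).
at : {n : ℕ} → Point n → ℕ → ℕ → ℚ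
at {n} x i j with i ℕ.<? suc n | j ℕ.<? suc n
... | yes p | yes q with fromℕ< p Fin.<? fromℕ< q
...   | yes r = x (fromℕ< p , fromℕ< q , r)
...   | no  _ = 0ℚ
at {n} x i j | _ | _ = 0ℚ

Ineqs : (n : ℕ) → Point n → Set
Ineqs n x =
    (at x 0 n ≤ 1ℚ)
  × (∀ i → 1 ℕ.≤ i → i ℕ.≤ n ∸ 1 → at x i n ≤ at x (i ∸ 1) n)
  × (∀ i → 1 ℕ.≤ i → i ℕ.≤ n ∸ 1 → at x 0 i ≤ at x 0 (suc i))
  × (∀ i → 1 ℕ.≤ i → i ℕ.≤ n ∸ 1 → at x (i ∸ 1) (suc i) ≤ at x (i ∸ 1) i + at x i (suc i))
  × (∀ j k → k ℕ.≤ n → j ℕ.< k ∸ 2 →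
       at x j k + at x (suc j) (k ∸ 1) ≤ at x (suc j) k + at x j (k ∸ 1))

{-# OPTIONS --safe #-}
module Submission where

-- Write y_ab = 1 - x_ab; for a convex combination of lifted multicuts it is the probability that a
-- and b lie in a common block. Blocks are intervals, so a block containing a and b contains every
-- vertex between them; hence every lifted multicut satisfies the inequalities, and they survive
-- convex combination.
--
-- Conversely, given x satisfying the inequalities, we build random decompositions of the paths
-- 0 … m, m = 0, 1, …, n, adding one vertex at a time. The block of m starts at a with probability
-- y_{a,m} - y_{a-1,m} (where y_{-1,m} = 0). Vertex m + 1 joins the block of m with a probability
-- depending only on where that block starts: starting at a, it joins with probability
--   (y_{a,m+1} - y_{a-1,m+1}) / (y_{a,m} - y_{a-1,m}),
-- which reproduces y_{a,m+1} for every a by telescoping. The inequalities give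
-- 0 ≤ numerator ≤ denominator, so these are probabilities, and at m = n the construction exhibits
-- x as a convex combination.

open import Defs
open import Data.Nat as ℕ using (ℕ; zero; suc; _≤_; _<_; z≤n; s≤s; _≤?_; _<?_; _≟_)
import Data.Nat.Properties as ℕP
open import Data.Fin as Fin using (Fin; fromℕ<; toℕ)
import Data.Fin.Properties as FinP
open import Data.Rational as ℚ using (ℚ; 0ℚ; 1ℚ; _+_; _*_; _-_; -_; _÷_; 1/_) renaming (_≤_ to _≤ℚ_)
import Data.Rational.Properties as ℚP
open import Data.Product using (_×_; _,_; proj₁; proj₂; map₂)
open import Data.Sum using (inj₁; inj₂)
open import Data.List using (List; []; _∷_; map)
open import Data.List.Relation.Unary.All using (All; []; _∷_)
import Data.List.Relation.Unary.All.Properties as All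
open import Relation.Binary.PropositionalEquality
open import Relation.Binary.Definitions using (tri<; tri≈; tri>)
open import Relation.Nullary using (Dec; yes; no; ¬_)
open import Relation.Nullary.Decidable using (¬?; dec⇒maybe)
open import Data.Empty using (⊥-elim)
open import Function using (_∘_)
open import Function.Bundles using (_⇔_; mk⇔)
open import Tactic.RingSolver using (solve-∀)
open import Tactic.RingSolver.Core.AlmostCommutativeRing using (AlmostCommutativeRing; fromCommutativeRing)

private
  variable
    A B P Q R S : Set

-- A genuine zero test is needed for the solver to cancel rational constants.
ℚ-ring : AlmostCommutativeRing _ _
ℚ-ring = fromCommutativeRing ℚP.+-*-commutativeRing (λ q → dec⇒maybe (0ℚ ℚP.≟ q))

0≤1 : 0ℚ ≤ℚ 1ℚ
0≤1 = ℚP.nonNegative⁻¹ 1ℚ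

0≤* : ∀ {p q} → 0ℚ ≤ℚ p → 0ℚ ≤ℚ q → 0ℚ ≤ℚ p * q
0≤* {p} {q} 0≤p 0≤q = ℚP.nonNegative⁻¹ (p * q)
  {{ℚP.nonNeg*nonNeg⇒nonNeg p {{ℚ.nonNegative 0≤p}} q {{ℚ.nonNegative 0≤q}}}}

≤⇒0≤- : ∀ {p q} → p ≤ℚ q → 0ℚ ≤ℚ q - p
≤⇒0≤- {p} {q} p≤q = subst (_≤ℚ q - p) (ℚP.+-inverseʳ p) (ℚP.+-monoˡ-≤ (- p) p≤q)

0≤-⇒≤ : ∀ {p q} → 0ℚ ≤ℚ q - p → p ≤ℚ q
0≤-⇒≤ {p} {q} 0≤q-p = subst₂ _≤ℚ_ (ℚP.+-identityˡ p) (cancel p q) (ℚP.+-monoˡ-≤ p 0≤q-p)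
  where
  cancel : ∀ p q → q - p + p ≡ q
  cancel = solve-∀ ℚ-ring

≤-via-difference : ∀ {p q p′ q′} → q′ - p′ ≡ q - p → p′ ≤ℚ q′ → p ≤ℚ q
≤-via-difference eq p′≤q′ = 0≤-⇒≤ (subst (0ℚ ≤ℚ_) eq (≤⇒0≤- p′≤q′))

𝟙 : Dec P → ℚ
𝟙 (yes _) = 1ℚ
𝟙 (no _)  = 0ℚ

𝟙-yes : (P? : Dec P) → P → 𝟙 P? ≡ 1ℚ
𝟙-yes (yes _) _ = refl
𝟙-yes (no ¬p) p = ⊥-elim (¬p p)

𝟙-no : (P? : Dec P) → ¬ P → 𝟙 P? ≡ 0ℚ
𝟙-no (yes p) ¬p = ⊥-elim (¬p p)
𝟙-no (no _)  _  = refl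

0≤𝟙 : (P? : Dec P) → 0ℚ ≤ℚ 𝟙 P?
0≤𝟙 (yes _) = 0≤1
0≤𝟙 (no _)  = ℚP.≤-refl

𝟙≤1 : (P? : Dec P) → 𝟙 P? ≤ℚ 1ℚ
𝟙≤1 (yes _) = ℚP.≤-refl
𝟙≤1 (no _)  = 0≤1

𝟙-cong : (P? : Dec P) (Q? : Dec Q) → (P → Q) → (Q → P) → 𝟙 P? ≡ 𝟙 Q?
𝟙-cong (yes p) Q? p→q _   = sym (𝟙-yes Q? (p→q p))
𝟙-cong (no ¬p) Q? _   q→p = sym (𝟙-no Q? (¬p ∘ q→p))

𝟙-¬? : (P? : Dec P) → 𝟙 (¬? P?) ≡ 1ℚ - 𝟙 P?
𝟙-¬? (yes _) = refl
𝟙-¬? (no _)  = refl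

𝟙-¬?-mono : (P? : Dec P) (Q? : Dec Q) → (Q → P) → 𝟙 (¬? P?) ≤ℚ 𝟙 (¬? Q?)
𝟙-¬?-mono (yes _) Q?      _   = 0≤𝟙 (¬? Q?)
𝟙-¬?-mono (no ¬p) (yes q) q→p = ⊥-elim (¬p (q→p q))
𝟙-¬?-mono (no _)  (no _)  _   = ℚP.≤-refl

𝟙-¬?-triangle : (P? : Dec P) (Q? : Dec Q) (R? : Dec R) → (Q → R → P) →
                𝟙 (¬? P?) ≤ℚ 𝟙 (¬? Q?) + 𝟙 (¬? R?)
𝟙-¬?-triangle (yes _) Q?      R?      _ = ℚP.+-mono-≤ (0≤𝟙 (¬? Q?)) (0≤𝟙 (¬? R?))
𝟙-¬?-triangle (no ¬p) (yes q) (yes r) h = ⊥-elim (¬p (h q r))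
𝟙-¬?-triangle (no _)  (yes _) (no _)  _ = ℚP.≤-refl
𝟙-¬?-triangle (no _)  (no _)  R?      _ =
  subst (_≤ℚ 1ℚ + 𝟙 (¬? R?)) (ℚP.+-identityʳ 1ℚ) (ℚP.+-monoʳ-≤ 1ℚ (0≤𝟙 (¬? R?)))

-- When S holds this is the triangle inequality; otherwise Q and R fail too and the right-hand side is 2.
𝟙-¬?-submodular : (P? : Dec P) (S? : Dec S) (Q? : Dec Q) (R? : Dec R) →
                  (Q → S) → (R → S) → (Q → R → P) →
                  𝟙 (¬? P?) + 𝟙 (¬? S?) ≤ℚ 𝟙 (¬? Q?) + 𝟙 (¬? R?)
𝟙-¬?-submodular P? (yes _) Q?      R?      _   _   h =
  subst (_≤ℚ 𝟙 (¬? Q?) + 𝟙 (¬? R?)) (sym (ℚP.+-identityʳ (𝟙 (¬? P?)))) (𝟙-¬?-triangle P? Q? R? h)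
𝟙-¬?-submodular P? (no ¬s) (yes q) R?      q→s _   _ = ⊥-elim (¬s (q→s q))
𝟙-¬?-submodular P? (no ¬s) (no _)  (yes r) _   r→s _ = ⊥-elim (¬s (r→s r))
𝟙-¬?-submodular P? (no _)  (no _)  (no _)  _   _   _ = ℚP.+-monoˡ-≤ 1ℚ (𝟙≤1 (¬? P?))

Weighted : Set → Set
Weighted A = List (ℚ × A)

NonNegWeights : Weighted A → Set
NonNegWeights = All ((0ℚ ≤ℚ_) ∘ proj₁)

-- Written with sumℚ and map so that combo ws p is 𝔼 ws (λ d → χ d p) by definition.
𝔼 : Weighted A → (A → ℚ) → ℚ
𝔼 ws g = sumℚ (map (λ w → proj₁ w * g (proj₂ w)) ws)

𝔼-cong : ∀ ws {g h : A → ℚ} → (∀ a → g a ≡ h a) → 𝔼 ws g ≡ 𝔼 ws h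
𝔼-cong []             _   = refl
𝔼-cong ((w , a) ∷ ws) g≗h = cong₂ _+_ (cong (w *_) (g≗h a)) (𝔼-cong ws g≗h)

𝔼-0 : ∀ (ws : Weighted A) → 𝔼 ws (λ _ → 0ℚ) ≡ 0ℚ
𝔼-0 []             = refl
𝔼-0 ((w , _) ∷ ws) = cong₂ _+_ (ℚP.*-zeroʳ w) (𝔼-0 ws)

𝔼-1 : ∀ (ws : Weighted A) → 𝔼 ws (λ _ → 1ℚ) ≡ sumℚ (map proj₁ ws)
𝔼-1 []             = refl
𝔼-1 ((w , _) ∷ ws) = cong₂ _+_ (ℚP.*-identityʳ w) (𝔼-1 ws)

𝔼-+ : ∀ ws (g h : A → ℚ) → 𝔼 ws (λ a → g a + h a) ≡ 𝔼 ws g + 𝔼 ws h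
𝔼-+ []             g h = refl
𝔼-+ ((w , a) ∷ ws) g h =
  trans (cong (w * (g a + h a) +_) (𝔼-+ ws g h)) (regroup w (g a) (h a) (𝔼 ws g) (𝔼 ws h))
  where
  regroup : ∀ w x y u v → w * (x + y) + (u + v) ≡ (w * x + u) + (w * y + v)
  regroup = solve-∀ ℚ-ring

𝔼-- : ∀ ws (g h : A → ℚ) → 𝔼 ws (λ a → g a - h a) ≡ 𝔼 ws g - 𝔼 ws h
𝔼-- []             g h = refl
𝔼-- ((w , a) ∷ ws) g h =
  trans (cong (w * (g a - h a) +_) (𝔼-- ws g h)) (regroup w (g a) (h a) (𝔼 ws g) (𝔼 ws h))
  where
  regroup : ∀ w x y u v → w * (x - y) + (u - v) ≡ (w * x + u) - (w * y + v)
  regroup = solve-∀ ℚ-ring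

𝔼-* : ∀ ws c (g : A → ℚ) → 𝔼 ws (λ a → c * g a) ≡ c * 𝔼 ws g
𝔼-* []             c g = sym (ℚP.*-zeroʳ c)
𝔼-* ((w , a) ∷ ws) c g = trans (cong (w * (c * g a) +_) (𝔼-* ws c g)) (regroup w c (g a) (𝔼 ws g))
  where
  regroup : ∀ w c x u → w * (c * x) + c * u ≡ c * (w * x + u)
  regroup = solve-∀ ℚ-ring

𝔼-mono : ∀ ws {g h : A → ℚ} → NonNegWeights ws → (∀ a → g a ≤ℚ h a) → 𝔼 ws g ≤ℚ 𝔼 ws h
𝔼-mono []             []           _   = ℚP.≤-refl
𝔼-mono ((w , a) ∷ ws) (0≤w ∷ 0≤ws) g≤h =
  ℚP.+-mono-≤ (ℚP.*-monoˡ-≤-nonNeg w {{ℚ.nonNegative 0≤w}} (g≤h a)) (𝔼-mono ws 0≤ws g≤h)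

𝔼-map : ∀ ws (f : A → B) (g : B → ℚ) → 𝔼 (map (map₂ f) ws) g ≡ 𝔼 ws (g ∘ f)
𝔼-map []             f g = refl
𝔼-map ((w , a) ∷ ws) f g = cong (w * g (f a) +_) (𝔼-map ws f g)

split : (A → ℚ) → (A → B) → (A → B) → Weighted A → Weighted B
split p f g []             = []
split p f g ((w , a) ∷ ws) = (w * p a , f a) ∷ (w * (1ℚ - p a) , g a) ∷ split p f g ws

𝔼-split : ∀ (p : A → ℚ) (f g : A → B) ws (h : B → ℚ) →
          𝔼 (split p f g ws) h ≡ 𝔼 ws (λ a → p a * h (f a) + (1ℚ - p a) * h (g a))
𝔼-split p f g []             h = refl
𝔼-split p f g ((w , a) ∷ ws) h =
  trans (cong (λ u → w * p a * h (f a) + (w * (1ℚ - p a) * h (g a) + u)) (𝔼-split p f g ws h))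
        (regroup w (p a) (h (f a)) (h (g a)) (𝔼 ws (λ a → p a * h (f a) + (1ℚ - p a) * h (g a))))
  where
  regroup : ∀ w p x y u → w * p * x + (w * (1ℚ - p) * y + u) ≡ w * (p * x + (1ℚ - p) * y) + u
  regroup = solve-∀ ℚ-ring

split-nonNeg : ∀ (p : A → ℚ) (f g : A → B) ws → (∀ a → 0ℚ ≤ℚ p a) → (∀ a → p a ≤ℚ 1ℚ) →
               NonNegWeights ws → NonNegWeights (split p f g ws)
split-nonNeg p f g []             _   _   []           = []
split-nonNeg p f g ((w , a) ∷ ws) 0≤p p≤1 (0≤w ∷ 0≤ws) =
  0≤* 0≤w (0≤p a) ∷ 0≤* 0≤w (≤⇒0≤- (p≤1 a)) ∷ split-nonNeg p f g ws 0≤p p≤1 0≤ws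

Δ : (ℕ → ℚ) → ℕ → ℚ
Δ F zero    = F zero
Δ F (suc a) = F (suc a) - F a

Δ-cong : ∀ {F G : ℕ → ℚ} a → (∀ b → b ≤ a → F b ≡ G b) → Δ F a ≡ Δ G a
Δ-cong zero    F≗G = F≗G 0 z≤n
Δ-cong (suc a) F≗G = cong₂ _-_ (F≗G (suc a) ℕP.≤-refl) (F≗G a (ℕP.n≤1+n a))

Δ-injective : ∀ {F G : ℕ → ℚ} a → (∀ b → b ≤ a → Δ F b ≡ Δ G b) → F a ≡ G a
Δ-injective         zero    ΔF≗ΔG = ΔF≗ΔG 0 z≤n
Δ-injective {F} {G} (suc a) ΔF≗ΔG = begin
  F (suc a)          ≡⟨ telescope (F (suc a)) (F a) ⟨
  Δ F (suc a) + F a  ≡⟨ cong₂ _+_ (ΔF≗ΔG (suc a) ℕP.≤-refl)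
                                 (Δ-injective a (λ b → ΔF≗ΔG b ∘ ℕP.m≤n⇒m≤1+n)) ⟩
  Δ G (suc a) + G a  ≡⟨ telescope (G (suc a)) (G a) ⟩
  G (suc a)          ∎
  where
  open ≡-Reasoning
  telescope : ∀ x y → x - y + y ≡ x
  telescope = solve-∀ ℚ-ring

Δ-* : ∀ c (F : ℕ → ℚ) a → Δ (λ b → c * F b) a ≡ c * Δ F a
Δ-* c F zero    = refl
Δ-* c F (suc a) = distrib c (F (suc a)) (F a)
  where
  distrib : ∀ c x y → c * x - c * y ≡ c * (x - y)
  distrib = solve-∀ ℚ-ring

𝔼-Δ : ∀ ws (F : A → ℕ → ℚ) a → 𝔼 ws (λ s → Δ (F s) a) ≡ Δ (λ b → 𝔼 ws (λ s → F s b)) a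
𝔼-Δ ws F zero    = refl
𝔼-Δ ws F (suc a) = 𝔼-- ws (λ s → F s (suc a)) (λ s → F s a)

Δ-𝟙-≤ : ∀ s a → Δ (λ b → 𝟙 (s ≤? b)) a ≡ 𝟙 (s ≟ a)
Δ-𝟙-≤ zero    zero = refl
Δ-𝟙-≤ (suc s) zero = refl
Δ-𝟙-≤ s (suc a) with ℕP.<-cmp s (suc a)
... | tri< s<1+a s≢1+a _
  rewrite 𝟙-yes (s ≤? suc a) (ℕP.<⇒≤ s<1+a) | 𝟙-yes (s ≤? a) (ℕ.s≤s⁻¹ s<1+a) | 𝟙-no (s ≟ suc a) s≢1+a
  = refl
... | tri≈ _ refl _
  rewrite 𝟙-yes (suc a ≤? suc a) ℕP.≤-refl | 𝟙-no (suc a ≤? a) ℕP.1+n≰n | 𝟙-yes (suc a ≟ suc a) refl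
  = refl
... | tri> _ s≢1+a 1+a<s
  rewrite 𝟙-no (s ≤? suc a) (ℕP.<⇒≱ 1+a<s) | 𝟙-no (s ≤? a) (ℕP.<⇒≱ (ℕP.<-trans (ℕP.n<1+n a) 1+a<s))
        | 𝟙-no (s ≟ suc a) s≢1+a
  = refl

𝟙-≟-weight : ∀ (c : ℕ → ℚ) s a → c s * 𝟙 (s ≟ a) ≡ c a * 𝟙 (s ≟ a)
𝟙-≟-weight c s a with s ≟ a
... | yes refl = refl
... | no _     = trans (ℚP.*-zeroʳ (c s)) (sym (ℚP.*-zeroʳ (c a)))

Δ-weighted-𝟙-≤ : ∀ (c : ℕ → ℚ) s a → Δ (λ b → c s * 𝟙 (s ≤? b)) a ≡ c a * Δ (λ b → 𝟙 (s ≤? b)) a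
Δ-weighted-𝟙-≤ c s a = begin
  Δ (λ b → c s * 𝟙 (s ≤? b)) a  ≡⟨ Δ-* (c s) (λ b → 𝟙 (s ≤? b)) a ⟩
  c s * Δ (λ b → 𝟙 (s ≤? b)) a  ≡⟨ cong (c s *_) (Δ-𝟙-≤ s a) ⟩
  c s * 𝟙 (s ≟ a)               ≡⟨ 𝟙-≟-weight c s a ⟩
  c a * 𝟙 (s ≟ a)               ≡⟨ cong (c a *_) (Δ-𝟙-≤ s a) ⟨
  c a * Δ (λ b → 𝟙 (s ≤? b)) a  ∎
  where open ≡-Reasoning

-- p / q, with the junk value 0 when q = 0.
ratio : ℚ → ℚ → ℚ
ratio p q with q ℚP.≟ 0ℚ
... | yes _  = 0ℚ
... | no q≢0 = (p ÷ q) {{ℚ.≢-nonZero q≢0}}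

ratio-spec : ∀ {p q} → 0ℚ ≤ℚ p → p ≤ℚ q → 0ℚ ≤ℚ ratio p q × ratio p q ≤ℚ 1ℚ × ratio p q * q ≡ p
ratio-spec {p} {q} 0≤p p≤q with q ℚP.≟ 0ℚ
... | yes refl = ℚP.≤-refl , 0≤1 , ℚP.≤-antisym 0≤p p≤q
... | no q≢0  = 0≤* 0≤p (ℚP.nonNegative⁻¹ (1/ q)) , p/q≤1 , p/q*q≡p
  where
  instance
    _ : ℚ.NonZero q
    _ = ℚ.≢-nonZero q≢0
    _ : ℚ.Positive q
    _ = ℚP.nonNeg∧nonZero⇒pos q {{ℚ.nonNegative (ℚP.≤-trans 0≤p p≤q)}}
    _ : ℚ.Positive (1/ q)
    _ = ℚP.1/pos⇒pos q
    _ : ℚ.NonNegative (1/ q)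
    _ = ℚP.pos⇒nonNeg (1/ q)
  p/q≤1 : p * 1/ q ≤ℚ 1ℚ
  p/q≤1 = subst (p * 1/ q ≤ℚ_) (ℚP.*-inverseʳ q) (ℚP.*-monoʳ-≤-nonNeg (1/ q) p≤q)
  p/q*q≡p : p * 1/ q * q ≡ p
  p/q*q≡p = trans (ℚP.*-assoc p (1/ q) q) (trans (cong (p *_) (ℚP.*-inverseˡ q)) (ℚP.*-identityʳ p))

downward-induction : ∀ (P : ℕ → Set) {l n} → P n → (∀ {k} → l ≤ k → k < n → P (suc k) → P k) →
                     ∀ {k} → l ≤ k → k ≤ n → P k
downward-induction P {l} {n} Pn step {k} l≤k k≤n = go (n ℕ.∸ k) l≤k (ℕP.m∸n+n≡m k≤n)
  where
  go : ∀ d {k} → l ≤ k → d ℕ.+ k ≡ n → P k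
  go zero        _   refl  = Pn
  go (suc d) {k} l≤k d+k≡n = step l≤k (subst (k <_) d+k≡n (s≤s (ℕP.m≤n+m k d)))
                                  (go d (ℕP.m≤n⇒m≤1+n l≤k) (trans (ℕP.+-suc d k) d+k≡n))

≤∸1⇒< : ∀ {i n} → 1 ≤ i → i ≤ n ℕ.∸ 1 → i < n
≤∸1⇒< {n = zero}  1≤i i≤0 = ⊥-elim (ℕP.<⇒≱ 1≤i i≤0)
≤∸1⇒< {n = suc n} _   i≤n = s≤s i≤n

vertex : ∀ {n i} → .(i ≤ n) → Fin (suc n)
vertex i≤n = fromℕ< (s≤s i≤n)

toℕ-vertex : ∀ {n i} .(i≤n : i ≤ n) → toℕ (vertex {n} i≤n) ≡ i
toℕ-vertex i≤n = FinP.toℕ-fromℕ< (s≤s i≤n)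

vertex-≡ : ∀ {n i j} .(i≤n : i ≤ n) .(j≤n : j ≤ n) → i ≡ j → vertex {n} i≤n ≡ vertex j≤n
vertex-≡ _ _ refl = refl

vertex-injective : ∀ {n i j} .(i≤n : i ≤ n) .(j≤n : j ≤ n) → vertex {n} i≤n ≡ vertex j≤n → i ≡ j
vertex-injective i≤n j≤n e = trans (sym (toℕ-vertex i≤n)) (trans (cong toℕ e) (toℕ-vertex j≤n))

vertex-mono-< : ∀ {n i j} .(i≤n : i ≤ n) .(j≤n : j ≤ n) → i < j → vertex {n} i≤n Fin.< vertex j≤n
vertex-mono-< i≤n j≤n = subst₂ _<_ (sym (toℕ-vertex i≤n)) (sym (toℕ-vertex j≤n))

pair : ∀ {n i j} → i < j → j ≤ n → Pair n
pair i<j j≤n = vertex i≤n , vertex j≤n , vertex-mono-< i≤n j≤n i<j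
  where i≤n = ℕP.≤-trans (ℕP.<⇒≤ i<j) j≤n

Pair-≡ : ∀ {n} {a a′ b b′ : Fin (suc n)} {r : a Fin.< b} {r′ : a′ Fin.< b′} →
         a ≡ a′ → b ≡ b′ → _≡_ {A = Pair n} (a , b , r) (a′ , b′ , r′)
Pair-≡ {a = a} {b = b} {r = r} {r′ = r′} refl refl = cong (λ r → a , b , r) (ℕP.<-irrelevant r r′)

module _ {n} (x : Point n) where

  at-pair : ∀ {i j} (i<j : i < j) (j≤n : j ≤ n) → at x i j ≡ x (pair i<j j≤n)
  at-pair {i} {j} i<j j≤n = go (ℕP.≤-trans (ℕP.<⇒≤ i<j) j≤n)
    where
    go : i ≤ n → at x i j ≡ x (pair i<j j≤n)
    go i≤n with i <? suc n | j <? suc n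
    ... | yes _    | yes _    with fromℕ< (s≤s i≤n) Fin.<? fromℕ< (s≤s j≤n)
    ...   | yes _ = cong x (Pair-≡ refl refl)
    ...   | no ¬r = ⊥-elim (¬r (vertex-mono-< i≤n j≤n i<j))
    go i≤n | no i≮1+n | _        = ⊥-elim (i≮1+n (s≤s i≤n))
    go i≤n | yes _    | no j≮1+n = ⊥-elim (j≮1+n (s≤s j≤n))

  at-diag : ∀ i → at x i i ≡ 0ℚ
  at-diag i with i <? suc n
  ... | yes i<1+n with fromℕ< i<1+n Fin.<? fromℕ< i<1+n
  ...   | yes i<i = ⊥-elim (ℕP.<-irrefl refl i<i)
  ...   | no _    = refl
  at-diag i | no _ = refl

  at-toℕ : ∀ ((a , b , a<b) : Pair n) → at x (toℕ a) (toℕ b) ≡ x (a , b , a<b)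
  at-toℕ (a , b , a<b) = trans (at-pair a<b (ℕ.s≤s⁻¹ (FinP.toℕ<n b)))
                               (cong x (Pair-≡ (FinP.fromℕ<-toℕ a _) (FinP.fromℕ<-toℕ b _)))

at-𝔼 : ∀ {n} {x : Point n} (ws : Weighted (Decomposition n)) → (∀ p → x p ≡ combo ws p) →
       ∀ i j → at x i j ≡ 𝔼 ws (λ d → at (χ d) i j)
at-𝔼 {n} ws x≡ i j with i <? suc n | j <? suc n
... | yes p | yes q with fromℕ< p Fin.<? fromℕ< q
...   | yes _ = x≡ _
...   | no _  = sym (𝔼-0 ws)
at-𝔼 ws x≡ i j | yes _ | no _ = sym (𝔼-0 ws)
at-𝔼 ws x≡ i j | no _  | _    = sym (𝔼-0 ws)

χ-≟ : ∀ {n} (d : Decomposition n) {a b} (a<b : a Fin.< b) →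
      χ d (a , b , a<b) ≡ 𝟙 (¬? (proj₁ d a Fin.≟ proj₁ d b))
χ-≟ (f , _) {a} {b} _ with f a Fin.≟ f b
... | yes _ = refl
... | no _  = refl

module DecompositionFacts {n} (d : Decomposition n) where

  private
    block : ∀ {i} → .(i ≤ n) → Fin (suc n)
    block i≤n = proj₁ d (vertex i≤n)

    same? : ∀ {i j} .(i≤n : i ≤ n) .(j≤n : j ≤ n) → Dec (block i≤n ≡ block j≤n)
    same? i≤n j≤n = block i≤n Fin.≟ block j≤n

  block-between : ∀ {a b c} (a≤n : a ≤ n) (c≤n : c ≤ n) (b≤n : b ≤ n) → a ≤ c → c ≤ b →
                  block a≤n ≡ block b≤n → block c≤n ≡ block a≤n
  block-between {a} {b} {c} a≤n c≤n b≤n a≤c c≤b fa≡fb with c ≟ a | c ≟ b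
  ... | yes refl | _        = refl
  ... | no _     | yes refl = sym fa≡fb
  ... | no c≢a   | no c≢b   = proj₂ d (vertex a≤n) (vertex b≤n) (vertex c≤n)
    (vertex-mono-< a≤n c≤n (ℕP.≤∧≢⇒< a≤c (c≢a ∘ sym)))
    (vertex-mono-< c≤n b≤n (ℕP.≤∧≢⇒< c≤b c≢b)) fa≡fb

  χ-at : ∀ {i j} (i≤n : i ≤ n) (j≤n : j ≤ n) (i<j : i < j) → at (χ d) i j ≡ 𝟙 (¬? (same? i≤n j≤n))
  χ-at i≤n j≤n i<j = trans (at-pair (χ d) i<j j≤n) (χ-≟ d (proj₂ (proj₂ (pair i<j j≤n))))

  χ-≤1 : ∀ {a b} → a < b → b ≤ n → at (χ d) a b ≤ℚ 1ℚ
  χ-≤1 a<b b≤n = subst (_≤ℚ 1ℚ) (sym (χ-at a≤n b≤n a<b)) (𝟙≤1 (¬? (same? a≤n b≤n)))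
    where a≤n = ℕP.≤-trans (ℕP.<⇒≤ a<b) b≤n

  χ-nested : ∀ {a a′ b′ b} → a ≤ a′ → a′ < b′ → b′ ≤ b → b ≤ n → at (χ d) a′ b′ ≤ℚ at (χ d) a b
  χ-nested a≤a′ a′<b′ b′≤b b≤n = subst₂ _≤ℚ_ (sym (χ-at a′≤n b′≤n a′<b′)) (sym (χ-at a≤n b≤n a<b))
    (𝟙-¬?-mono (same? a′≤n b′≤n) (same? a≤n b≤n) inner-same)
    where
    b′≤n = ℕP.≤-trans b′≤b b≤n
    a′≤n = ℕP.≤-trans (ℕP.<⇒≤ a′<b′) b′≤n
    a≤n  = ℕP.≤-trans a≤a′ a′≤n
    a′≤b = ℕP.≤-trans (ℕP.<⇒≤ a′<b′) b′≤b
    a≤b′ = ℕP.≤-trans a≤a′ (ℕP.<⇒≤ a′<b′)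
    a<b  = ℕP.≤-<-trans a≤a′ (ℕP.<-≤-trans a′<b′ b′≤b)
    inner-same : block a≤n ≡ block b≤n → block a′≤n ≡ block b′≤n
    inner-same e = trans (block-between a≤n a′≤n b≤n a≤a′ a′≤b e)
                         (sym (block-between a≤n b′≤n b≤n a≤b′ b′≤b e))

  χ-triangle : ∀ {a b c} → a < b → b < c → c ≤ n → at (χ d) a c ≤ℚ at (χ d) a b + at (χ d) b c
  χ-triangle a<b b<c c≤n =
    subst₂ _≤ℚ_ (sym (χ-at a≤n c≤n (ℕP.<-trans a<b b<c)))
                (sym (cong₂ _+_ (χ-at a≤n b≤n a<b) (χ-at b≤n c≤n b<c)))
      (𝟙-¬?-triangle (same? a≤n c≤n) (same? a≤n b≤n) (same? b≤n c≤n) trans)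
    where
    b≤n = ℕP.≤-trans (ℕP.<⇒≤ b<c) c≤n
    a≤n = ℕP.≤-trans (ℕP.<⇒≤ a<b) b≤n

  χ-submodular : ∀ {a a′ b′ b} → a ≤ a′ → a′ < b′ → b′ ≤ b → b ≤ n →
                 at (χ d) a b + at (χ d) a′ b′ ≤ℚ at (χ d) a′ b + at (χ d) a b′
  χ-submodular a≤a′ a′<b′ b′≤b b≤n =
    subst₂ _≤ℚ_ (sym (cong₂ _+_ (χ-at a≤n b≤n a<b) (χ-at a′≤n b′≤n a′<b′)))
                (sym (cong₂ _+_ (χ-at a′≤n b≤n a′<b) (χ-at a≤n b′≤n a<b′)))
      (𝟙-¬?-submodular (same? a≤n b≤n) (same? a′≤n b′≤n) (same? a′≤n b≤n) (same? a≤n b′≤n)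
                       outer→inner cross→inner crosses→outer)
    where
    b′≤n = ℕP.≤-trans b′≤b b≤n
    a′≤n = ℕP.≤-trans (ℕP.<⇒≤ a′<b′) b′≤n
    a≤n  = ℕP.≤-trans a≤a′ a′≤n
    a<b′ = ℕP.≤-<-trans a≤a′ a′<b′
    a′<b = ℕP.<-≤-trans a′<b′ b′≤b
    a<b  = ℕP.≤-<-trans a≤a′ a′<b
    outer→inner : block a′≤n ≡ block b≤n → block a′≤n ≡ block b′≤n
    outer→inner e = sym (block-between a′≤n b′≤n b≤n (ℕP.<⇒≤ a′<b′) b′≤b e)
    cross→inner : block a≤n ≡ block b′≤n → block a′≤n ≡ block b′≤n
    cross→inner e = trans (block-between a≤n a′≤n b′≤n a≤a′ (ℕP.<⇒≤ a′<b′) e) e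
    crosses→outer : block a′≤n ≡ block b≤n → block a≤n ≡ block b′≤n → block a≤n ≡ block b≤n
    crosses→outer e₁ e₂ = trans e₂ (trans (sym (outer→inner e₁)) e₁)

module ConvexCombination {n} {x : Point n} (ws : Weighted (Decomposition n)) (0≤ws : NonNegWeights ws)
                         (Σws≡1 : sumℚ (map proj₁ ws) ≡ 1ℚ) (x≡ : ∀ p → x p ≡ combo ws p) where

  open DecompositionFacts
  open ℚP.≤-Reasoning

  private
    E : ℕ → ℕ → ℚ
    E i j = 𝔼 ws (λ d → at (χ d) i j)

    x≡E : ∀ i j → at x i j ≡ E i j
    x≡E = at-𝔼 ws x≡

    E-+ : ∀ i j k l → 𝔼 ws (λ d → at (χ d) i j + at (χ d) k l) ≡ E i j + E k l
    E-+ i j k l = 𝔼-+ ws (λ d → at (χ d) i j) (λ d → at (χ d) k l)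

  x-≤1 : ∀ {a b} → a < b → b ≤ n → at x a b ≤ℚ 1ℚ
  x-≤1 {a} {b} a<b b≤n = begin
    at x a b         ≡⟨ x≡E a b ⟩
    E a b            ≤⟨ 𝔼-mono ws 0≤ws (λ d → χ-≤1 d a<b b≤n) ⟩
    𝔼 ws (λ _ → 1ℚ)  ≡⟨ trans (𝔼-1 ws) Σws≡1 ⟩
    1ℚ               ∎

  x-nested : ∀ {a a′ b′ b} → a ≤ a′ → a′ < b′ → b′ ≤ b → b ≤ n → at x a′ b′ ≤ℚ at x a b
  x-nested {a} {a′} {b′} {b} a≤a′ a′<b′ b′≤b b≤n = begin
    at x a′ b′  ≡⟨ x≡E a′ b′ ⟩
    E a′ b′     ≤⟨ 𝔼-mono ws 0≤ws (λ d → χ-nested d a≤a′ a′<b′ b′≤b b≤n) ⟩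
    E a b       ≡⟨ x≡E a b ⟨
    at x a b    ∎

  x-triangle : ∀ {a b c} → a < b → b < c → c ≤ n → at x a c ≤ℚ at x a b + at x b c
  x-triangle {a} {b} {c} a<b b<c c≤n = begin
    at x a c                                  ≡⟨ x≡E a c ⟩
    E a c                                     ≤⟨ 𝔼-mono ws 0≤ws (λ d → χ-triangle d a<b b<c c≤n) ⟩
    𝔼 ws (λ d → at (χ d) a b + at (χ d) b c)  ≡⟨ E-+ a b b c ⟩
    E a b + E b c                             ≡⟨ cong₂ _+_ (x≡E a b) (x≡E b c) ⟨
    at x a b + at x b c                       ∎

  x-submodular : ∀ {a a′ b′ b} → a ≤ a′ → a′ < b′ → b′ ≤ b → b ≤ n →
                 at x a b + at x a′ b′ ≤ℚ at x a′ b + at x a b′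
  x-submodular {a} {a′} {b′} {b} a≤a′ a′<b′ b′≤b b≤n = begin
    at x a b + at x a′ b′                       ≡⟨ cong₂ _+_ (x≡E a b) (x≡E a′ b′) ⟩
    E a b + E a′ b′                             ≡⟨ E-+ a b a′ b′ ⟨
    𝔼 ws (λ d → at (χ d) a b + at (χ d) a′ b′)
      ≤⟨ 𝔼-mono ws 0≤ws (λ d → χ-submodular d a≤a′ a′<b′ b′≤b b≤n) ⟩
    𝔼 ws (λ d → at (χ d) a′ b + at (χ d) a b′)  ≡⟨ E-+ a′ b a b′ ⟩
    E a′ b + E a b′                             ≡⟨ cong₂ _+_ (x≡E a′ b) (x≡E a b′) ⟨
    at x a′ b + at x a b′                       ∎

lmc⇒ineqs : ∀ {n} (x : Point n) → 2 ≤ n → InLMC n x → Ineqs n x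
lmc⇒ineqs {n} x 2≤n (ws , 0≤ws , Σws≡1 , x≡) = corner , leftEnd , firstRow , triangle , crossing
  where
  open ConvexCombination ws 0≤ws Σws≡1 x≡

  corner : at x 0 n ≤ℚ 1ℚ
  corner = x-≤1 (ℕP.<-trans (s≤s z≤n) 2≤n) ℕP.≤-refl

  leftEnd : ∀ i → 1 ≤ i → i ≤ n ℕ.∸ 1 → at x i n ≤ℚ at x (i ℕ.∸ 1) n
  leftEnd (suc i) 1≤i i<n = x-nested (ℕP.n≤1+n i) (≤∸1⇒< 1≤i i<n) ℕP.≤-refl ℕP.≤-refl

  firstRow : ∀ i → 1 ≤ i → i ≤ n ℕ.∸ 1 → at x 0 i ≤ℚ at x 0 (suc i)
  firstRow i 1≤i i<n = x-nested z≤n 1≤i (ℕP.n≤1+n i) (≤∸1⇒< 1≤i i<n)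

  triangle : ∀ i → 1 ≤ i → i ≤ n ℕ.∸ 1 → at x (i ℕ.∸ 1) (suc i) ≤ℚ at x (i ℕ.∸ 1) i + at x i (suc i)
  triangle (suc i) 1≤i i<n = x-triangle (ℕP.n<1+n i) (ℕP.n<1+n (suc i)) (≤∸1⇒< 1≤i i<n)

  crossing : ∀ j k → k ≤ n → j < k ℕ.∸ 2 →
             at x j k + at x (suc j) (k ℕ.∸ 1) ≤ℚ at x (suc j) k + at x j (k ℕ.∸ 1)
  crossing j (suc (suc (suc k))) k≤n (s≤s j≤k) =
    x-submodular (ℕP.n≤1+n j) (s≤s (s≤s j≤k)) (ℕP.n≤1+n _) k≤n

module IneqsConsequences {n} (x : Point n) (2≤n : 2 ≤ n) (ineqs : Ineqs n x) where

  private
    corner   = proj₁ ineqs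
    leftEnd  = proj₁ (proj₂ ineqs)
    firstRow = proj₁ (proj₂ (proj₂ ineqs))
    triangle = proj₁ (proj₂ (proj₂ (proj₂ ineqs)))
    crossing = proj₂ (proj₂ (proj₂ (proj₂ ineqs)))

  x-crossing : ∀ {a k} → suc a ≤ k → suc k ≤ n →
               at x a (suc k) + at x (suc a) k ≤ℚ at x (suc a) (suc k) + at x a k
  x-crossing {a} {k} 1+a≤k 1+k≤n with ℕP.m≤n⇒m<n∨m≡n 1+a≤k
  x-crossing {a} {suc k} _ 1+k≤n | inj₁ 1+a<1+k = crossing a (suc (suc k)) 1+k≤n (ℕ.s≤s⁻¹ 1+a<1+k)
  -- For k = a + 1 the crossing inequality is a triangle inequality, since x (a + 1) (a + 1) = 0.
  x-crossing {a} {k} _ 1+k≤n     | inj₂ refl rewrite at-diag x (suc a) =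
    ≤-via-difference (regroup (at x a (suc a)) (at x (suc a) (suc (suc a))) (at x a (suc (suc a))))
                     (triangle (suc a) (s≤s z≤n) (ℕP.<⇒≤pred 1+k≤n))
    where
    regroup : ∀ p q r → (p + q) - r ≡ (q + p) - (r + 0ℚ)
    regroup = solve-∀ ℚ-ring

  x-antitoneˡ : ∀ {a k} → suc a < k → k ≤ n → at x (suc a) k ≤ℚ at x a k
  x-antitoneˡ {a} 1+a<k k≤n = downward-induction (λ k → at x (suc a) k ≤ℚ at x a k) atEnd step 1+a<k k≤n
    where
    atEnd : at x (suc a) n ≤ℚ at x a n
    atEnd = leftEnd (suc a) (s≤s z≤n) (ℕP.<⇒≤pred (ℕP.<-≤-trans 1+a<k k≤n))
    step : ∀ {k} → suc (suc a) ≤ k → k < n →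
           at x (suc a) (suc k) ≤ℚ at x a (suc k) → at x (suc a) k ≤ℚ at x a k
    step {k} 2+a≤k k<n next =
      ≤-via-difference (regroup (at x a (suc k)) (at x (suc a) k) (at x (suc a) (suc k)) (at x a k))
                       (ℚP.+-mono-≤ (x-crossing (ℕP.<⇒≤ 2+a≤k) k<n) next)
      where
      regroup : ∀ p r q s → (q + s + p) - (p + r + q) ≡ s - r
      regroup = solve-∀ ℚ-ring

  x₀-≤1 : ∀ {k} → k ≤ n → at x 0 k ≤ℚ 1ℚ
  x₀-≤1 {zero}  _   = subst (_≤ℚ 1ℚ) (sym (at-diag x 0)) 0≤1
  x₀-≤1 {suc k} k≤n = downward-induction (λ k → at x 0 k ≤ℚ 1ℚ) corner step (s≤s z≤n) k≤n
    where
    step : ∀ {k} → 1 ≤ k → k < n → at x 0 (suc k) ≤ℚ 1ℚ → at x 0 k ≤ℚ 1ℚ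
    step {k} 1≤k k<n = ℚP.≤-trans (firstRow k 1≤k (ℕP.<⇒≤pred k<n))

  x₀-mono : ∀ {k} → suc k ≤ n → at x 0 k ≤ℚ at x 0 (suc k)
  x₀-mono {zero}  _     = subst (_≤ℚ at x 0 1) (sym (at-diag x 0)) x₀₁-nonNeg
    where
    -- The triangle inequality at 1 against x₁₂ ≤ x₀₂; this is where 2 ≤ n is needed.
    x₀₁-nonNeg : 0ℚ ≤ℚ at x 0 1
    x₀₁-nonNeg = ≤-via-difference (regroup (at x 0 2) (at x 0 1) (at x 1 2))
      (ℚP.+-mono-≤ (triangle 1 ℕP.≤-refl (ℕP.<⇒≤pred 2≤n)) (x-antitoneˡ ℕP.≤-refl 2≤n))
      where
      regroup : ∀ p q r → (q + r + p) - (p + r) ≡ q - 0ℚ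
      regroup = solve-∀ ℚ-ring
  x₀-mono {suc k} 2+k≤n = firstRow (suc k) (s≤s z≤n) (ℕP.<⇒≤pred 2+k≤n)

-- Decompositions of the path 0 … m, built left to right: vertex m + 1 either joins the block of m
-- or is cut off from it.
data Segmentation : ℕ → Set where
  singleton : Segmentation 0
  join cut  : ∀ {m} → Segmentation m → Segmentation (suc m)

extend : (ℕ → ℕ) → ℕ → ℕ → ℕ → ℕ
extend f m v k with k ≤? m
... | yes _ = f k
... | no _  = v

extend-≤ : ∀ f m v {k} → k ≤ m → extend f m v k ≡ f k
extend-≤ f m v {k} k≤m with k ≤? m
... | yes _  = refl
... | no k≰m = ⊥-elim (k≰m k≤m)

extend-suc : ∀ f m v → extend f m v (suc m) ≡ v
extend-suc f m v with suc m ≤? m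
... | yes 1+m≤m = ⊥-elim (ℕP.1+n≰n 1+m≤m)
... | no _      = refl

blockStart : ∀ {m} → Segmentation m → ℕ → ℕ
blockStart singleton    = λ _ → 0
blockStart (join {m} s) = extend (blockStart s) m (blockStart s m)
blockStart (cut {m} s)  = extend (blockStart s) m (suc m)

record IsBlockStart (m : ℕ) (st : ℕ → ℕ) : Set where
  field
    start≤    : ∀ {k} → k ≤ m → st k ≤ k
    sameStart : ∀ {i j} → i ≤ j → j ≤ m → st j ≤ i → st i ≡ st j

open IsBlockStart

extend-isBlockStart : ∀ {m st v} → IsBlockStart m st → v ≤ suc m → (∀ {i} → i ≤ m → v ≤ i → st i ≡ v) →
                      IsBlockStart (suc m) (extend st m v)
extend-isBlockStart {m} {st} {v} isBS v≤1+m v-joins = record { start≤ = start≤′ ; sameStart = sameStart′ }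
  where
  start≤′ : ∀ {k} → k ≤ suc m → extend st m v k ≤ k
  start≤′ {k} k≤1+m with ℕP.m≤n⇒m<n∨m≡n k≤1+m
  ... | inj₁ k<1+m rewrite extend-≤ st m v (ℕ.s≤s⁻¹ k<1+m) = start≤ isBS (ℕ.s≤s⁻¹ k<1+m)
  ... | inj₂ refl  rewrite extend-suc st m v                = v≤1+m

  sameStart′ : ∀ {i j} → i ≤ j → j ≤ suc m → extend st m v j ≤ i → extend st m v i ≡ extend st m v j
  sameStart′ {i} {j} i≤j j≤1+m st′j≤i with ℕP.m≤n⇒m<n∨m≡n j≤1+m | ℕP.m≤n⇒m<n∨m≡n (ℕP.≤-trans i≤j j≤1+m)
  ... | inj₁ j<1+m | _
    rewrite extend-≤ st m v (ℕ.s≤s⁻¹ j<1+m) | extend-≤ st m v (ℕP.≤-trans i≤j (ℕ.s≤s⁻¹ j<1+m))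
    = sameStart isBS i≤j (ℕ.s≤s⁻¹ j<1+m) st′j≤i
  ... | inj₂ refl | inj₁ i<1+m
    rewrite extend-suc st m v | extend-≤ st m v (ℕ.s≤s⁻¹ i<1+m)
    = v-joins (ℕ.s≤s⁻¹ i<1+m) st′j≤i
  ... | inj₂ refl | inj₂ refl = refl

blockStart-isBlockStart : ∀ {m} (s : Segmentation m) → IsBlockStart m (blockStart s)
blockStart-isBlockStart singleton = record { start≤ = λ _ → z≤n ; sameStart = λ _ _ _ → refl }
blockStart-isBlockStart (join s)  =
  extend-isBlockStart isBS (ℕP.m≤n⇒m≤1+n (start≤ isBS ℕP.≤-refl)) (λ i≤m → sameStart isBS i≤m ℕP.≤-refl)
  where isBS = blockStart-isBlockStart s
blockStart-isBlockStart (cut s)   =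
  extend-isBlockStart (blockStart-isBlockStart s) ℕP.≤-refl (λ i≤m 1+m≤i → ⊥-elim (ℕP.<⇒≱ 1+m≤i i≤m))

module _ {n st} (isBS : IsBlockStart n st) where

  private
    toℕ≤n : (v : Fin (suc n)) → toℕ v ≤ n
    toℕ≤n v = ℕ.s≤s⁻¹ (FinP.toℕ<n v)

    start≤n : (v : Fin (suc n)) → st (toℕ v) ≤ n
    start≤n v = ℕP.≤-trans (start≤ isBS (toℕ≤n v)) (toℕ≤n v)

    label : Fin (suc n) → Fin (suc n)
    label v = vertex (start≤n v)

    same-label⇒ : ∀ {a b} → a Fin.< b → label a ≡ label b → st (toℕ b) ≤ toℕ a
    same-label⇒ {a} {b} _ e =
      subst (_≤ toℕ a) (vertex-injective (start≤n a) (start≤n b) e) (start≤ isBS (toℕ≤n a))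

    same-label⇐ : ∀ {a b} → a Fin.< b → st (toℕ b) ≤ toℕ a → label a ≡ label b
    same-label⇐ {a} {b} a<b stb≤a =
      vertex-≡ (start≤n a) (start≤n b) (sameStart isBS (ℕP.<⇒≤ a<b) (toℕ≤n b) stb≤a)

    convex : IsDecomposition n label
    convex a b c a<c c<b e =
      trans (same-label⇐ c<b (ℕP.≤-trans (same-label⇒ (ℕP.<-trans a<c c<b) e) (ℕP.<⇒≤ a<c))) (sym e)

  decomposition : Decomposition n
  decomposition = label , convex

  χ-decomposition : ∀ {a b} (a<b : a Fin.< b) → χ decomposition (a , b , a<b) ≡ 1ℚ - 𝟙 (st (toℕ b) ≤? toℕ a)
  χ-decomposition {a} {b} a<b = begin
    χ decomposition (a , b , a<b)   ≡⟨ χ-≟ decomposition a<b ⟩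
    𝟙 (¬? (label a Fin.≟ label b))  ≡⟨ 𝟙-¬? (label a Fin.≟ label b) ⟩
    1ℚ - 𝟙 (label a Fin.≟ label b)  ≡⟨ cong (λ q → 1ℚ - q) same-label⇔ ⟩
    1ℚ - 𝟙 (st (toℕ b) ≤? toℕ a)    ∎
    where
    open ≡-Reasoning
    same-label⇔ : 𝟙 (label a Fin.≟ label b) ≡ 𝟙 (st (toℕ b) ≤? toℕ a)
    same-label⇔ = 𝟙-cong (label a Fin.≟ label b) (st (toℕ b) ≤? toℕ a) (same-label⇒ a<b) (same-label⇐ a<b)

module MarkovConstruction {n} (x : Point n) (2≤n : 2 ≤ n) (ineqs : Ineqs n x) where

  open IneqsConsequences x 2≤n ineqs

  together : ℕ → ℕ → ℚ
  together a b = 1ℚ - at x a b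

  startProb : ℕ → ℕ → ℚ
  startProb m = Δ (λ a → together a m)

  startProb-nonNeg : ∀ {a m} → a < m → m ≤ n → 0ℚ ≤ℚ startProb m a
  startProb-nonNeg {zero}      _     m≤n = ≤⇒0≤- (x₀-≤1 m≤n)
  startProb-nonNeg {suc a} {m} 1+a<m m≤n =
    ≤-via-difference (regroup (at x (suc a) m) (at x a m)) (x-antitoneˡ 1+a<m m≤n)
    where
    regroup : ∀ p q → q - p ≡ ((1ℚ - p) - (1ℚ - q)) - 0ℚ
    regroup = solve-∀ ℚ-ring

  startProb-mono : ∀ {a m} → a ≤ m → suc m ≤ n → startProb (suc m) a ≤ℚ startProb m a
  startProb-mono {zero}  {m} _ 1+m≤n =
    ≤-via-difference (regroup (at x 0 m) (at x 0 (suc m))) (x₀-mono 1+m≤n)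
    where
    regroup : ∀ p q → q - p ≡ (1ℚ - p) - (1ℚ - q)
    regroup = solve-∀ ℚ-ring
  startProb-mono {suc a} {m} 1+a≤m 1+m≤n =
    ≤-via-difference (regroup (at x a (suc m)) (at x (suc a) m) (at x (suc a) (suc m)) (at x a m))
                     (x-crossing 1+a≤m 1+m≤n)
    where
    regroup : ∀ p₁ p₂ q₁ q₂ → (q₁ + q₂) - (p₁ + p₂) ≡ ((1ℚ - p₂) - (1ℚ - q₂)) - ((1ℚ - q₁) - (1ℚ - p₁))
    regroup = solve-∀ ℚ-ring

  record Realisation (m : ℕ) : Set where
    field
      ws       : Weighted (Segmentation m)
      nonNeg   : NonNegWeights ws
      total    : 𝔼 ws (λ _ → 1ℚ) ≡ 1ℚ
      marginal : ∀ {a b} → a ≤ b → b ≤ m → 𝔼 ws (λ s → 𝟙 (blockStart s b ≤? a)) ≡ together a b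

  marginal-diag : ∀ {m} (ws : Weighted (Segmentation m)) → 𝔼 ws (λ _ → 1ℚ) ≡ 1ℚ →
                  ∀ {b} → b ≤ m → 𝔼 ws (λ s → 𝟙 (blockStart s b ≤? b)) ≡ together b b
  marginal-diag ws total {b} b≤m = begin
    𝔼 ws (λ s → 𝟙 (blockStart s b ≤? b))  ≡⟨ 𝔼-cong ws starts-weakly-before ⟩
    𝔼 ws (λ _ → 1ℚ)                       ≡⟨ total ⟩
    1ℚ                                    ≡⟨ cong (λ q → 1ℚ - q) (at-diag x b) ⟨
    together b b                          ∎
    where
    open ≡-Reasoning
    starts-weakly-before : ∀ s → 𝟙 (blockStart s b ≤? b) ≡ 1ℚ
    starts-weakly-before s = 𝟙-yes (blockStart s b ≤? b) (start≤ (blockStart-isBlockStart s) b≤m)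

  base : Realisation 0
  base = record
    { ws       = (1ℚ , singleton) ∷ []
    ; nonNeg   = 0≤1 ∷ []
    ; total    = refl
    ; marginal = λ { z≤n z≤n → marginal-diag ((1ℚ , singleton) ∷ []) refl z≤n }
    }

  module Step {m} (1+m≤n : suc m ≤ n) (R : Realisation m) where

    open Realisation R

    lastStart : Segmentation m → ℕ
    lastStart s = blockStart s m

    lastStart≤m : ∀ s → lastStart s ≤ m
    lastStart≤m s = start≤ (blockStart-isBlockStart s) ℕP.≤-refl

    joinProb : ℕ → ℚ
    joinProb a = ratio (startProb (suc m) a) (startProb m a)

    joinProb-spec : ∀ {a} → a ≤ m →
                    0ℚ ≤ℚ joinProb a × joinProb a ≤ℚ 1ℚ × joinProb a * startProb m a ≡ startProb (suc m) a
    joinProb-spec a≤m = ratio-spec (startProb-nonNeg (s≤s a≤m) 1+m≤n) (startProb-mono a≤m 1+m≤n)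

    ws′ : Weighted (Segmentation (suc m))
    ws′ = split (joinProb ∘ lastStart) join cut ws

    𝔼′ : (Segmentation (suc m) → ℚ) → ℚ
    𝔼′ h = 𝔼 ws (λ s → joinProb (lastStart s) * h (join s) + (1ℚ - joinProb (lastStart s)) * h (cut s))

    total′ : 𝔼 ws′ (λ _ → 1ℚ) ≡ 1ℚ
    total′ = trans (𝔼-split _ join cut ws _) (trans (𝔼-cong ws (λ s → mix (joinProb (lastStart s)))) total)
      where
      mix : ∀ p → p * 1ℚ + (1ℚ - p) * 1ℚ ≡ 1ℚ
      mix = solve-∀ ℚ-ring

    joined-≤ : ∀ {a} → a ≤ m → 𝔼 ws (λ s → joinProb (lastStart s) * 𝟙 (lastStart s ≤? a)) ≡ together a (suc m)
    joined-≤ {a} a≤m = Δ-injective a ΔF≗ΔG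
      where
      F : ℕ → Segmentation m → ℚ
      F a s = 𝟙 (lastStart s ≤? a)
      open ≡-Reasoning
      ΔF≗ΔG : ∀ b → b ≤ a → Δ (λ a → 𝔼 ws (λ s → joinProb (lastStart s) * F a s)) b ≡ startProb (suc m) b
      ΔF≗ΔG b b≤a = begin
        Δ (λ a → 𝔼 ws (λ s → joinProb (lastStart s) * F a s)) b
          ≡⟨ 𝔼-Δ ws (λ s a → joinProb (lastStart s) * F a s) b ⟨
        𝔼 ws (λ s → Δ (λ a → joinProb (lastStart s) * F a s) b)
          ≡⟨ 𝔼-cong ws (λ s → Δ-weighted-𝟙-≤ joinProb (lastStart s) b) ⟩
        𝔼 ws (λ s → joinProb b * Δ (λ a → F a s) b)
          ≡⟨ 𝔼-* ws (joinProb b) (λ s → Δ (λ a → F a s) b) ⟩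
        joinProb b * 𝔼 ws (λ s → Δ (λ a → F a s) b)
          ≡⟨ cong (joinProb b *_) (𝔼-Δ ws (λ s a → F a s) b) ⟩
        joinProb b * Δ (λ a → 𝔼 ws (F a)) b
          ≡⟨ cong (joinProb b *_) (Δ-cong b (λ c c≤b → marginal (ℕP.≤-trans c≤b b≤m) ℕP.≤-refl)) ⟩
        joinProb b * startProb m b
          ≡⟨ proj₂ (proj₂ (joinProb-spec b≤m)) ⟩
        startProb (suc m) b ∎
        where b≤m = ℕP.≤-trans b≤a a≤m

    marginal-old : ∀ {a b} → a ≤ b → b ≤ m → 𝔼′ (λ s → 𝟙 (blockStart s b ≤? a)) ≡ together a b
    marginal-old {a} {b} a≤b b≤m = trans (𝔼-cong ws unchanged) (marginal a≤b b≤m)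
      where
      mix : ∀ p u → p * u + (1ℚ - p) * u ≡ u
      mix = solve-∀ ℚ-ring
      unchanged : ∀ s → joinProb (lastStart s) * 𝟙 (blockStart (join s) b ≤? a)
                          + (1ℚ - joinProb (lastStart s)) * 𝟙 (blockStart (cut s) b ≤? a)
                        ≡ 𝟙 (blockStart s b ≤? a)
      unchanged s rewrite extend-≤ (blockStart s) m (lastStart s) b≤m | extend-≤ (blockStart s) m (suc m) b≤m =
        mix (joinProb (lastStart s)) (𝟙 (blockStart s b ≤? a))

    marginal-new : ∀ {a} → a ≤ m → 𝔼′ (λ s → 𝟙 (blockStart s (suc m) ≤? a)) ≡ together a (suc m)
    marginal-new {a} a≤m = trans (𝔼-cong ws only-joins) (joined-≤ a≤m)
      where
      drop-cut : ∀ p u → p * u + (1ℚ - p) * 0ℚ ≡ p * u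
      drop-cut = solve-∀ ℚ-ring
      only-joins : ∀ s → joinProb (lastStart s) * 𝟙 (blockStart (join s) (suc m) ≤? a)
                           + (1ℚ - joinProb (lastStart s)) * 𝟙 (blockStart (cut s) (suc m) ≤? a)
                         ≡ joinProb (lastStart s) * 𝟙 (lastStart s ≤? a)
      only-joins s rewrite extend-suc (blockStart s) m (lastStart s) | extend-suc (blockStart s) m (suc m)
                         | 𝟙-no (suc m ≤? a) (ℕP.<⇒≱ (s≤s a≤m))
        = drop-cut (joinProb (lastStart s)) (𝟙 (lastStart s ≤? a))

    marginal′ : ∀ {a b} → a ≤ b → b ≤ suc m → 𝔼 ws′ (λ s → 𝟙 (blockStart s b ≤? a)) ≡ together a b
    marginal′ {a} {b} a≤b b≤1+m with ℕP.m≤n⇒m<n∨m≡n b≤1+m | ℕP.m≤n⇒m<n∨m≡n (ℕP.≤-trans a≤b b≤1+m)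
    ... | inj₁ b<1+m | _          = trans (𝔼-split _ join cut ws _) (marginal-old a≤b (ℕ.s≤s⁻¹ b<1+m))
    ... | inj₂ refl  | inj₁ a<1+m = trans (𝔼-split _ join cut ws _) (marginal-new (ℕ.s≤s⁻¹ a<1+m))
    ... | inj₂ refl  | inj₂ refl  = marginal-diag ws′ total′ ℕP.≤-refl

    next : Realisation (suc m)
    next = record
      { ws       = ws′
      ; nonNeg   = split-nonNeg _ join cut ws (λ s → proj₁ (joinProb-spec (lastStart≤m s)))
                                               (λ s → proj₁ (proj₂ (joinProb-spec (lastStart≤m s)))) nonNeg
      ; total    = total′
      ; marginal = marginal′
      }

  realisation : ∀ {m} → m ≤ n → Realisation m
  realisation {zero}  _     = base
  realisation {suc m} 1+m≤n = Step.next 1+m≤n (realisation (ℕP.≤-trans (ℕP.n≤1+n m) 1+m≤n))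

  ineqs⇒lmc : InLMC n x
  ineqs⇒lmc = map (map₂ toDecomposition) ws , All.map⁺ nonNeg , Σws≡1 , x≡
    where
    open Realisation (realisation ℕP.≤-refl)
    open ≡-Reasoning

    toDecomposition : Segmentation n → Decomposition n
    toDecomposition s = decomposition (blockStart-isBlockStart s)

    Σws≡1 : sumℚ (map proj₁ (map (map₂ toDecomposition) ws)) ≡ 1ℚ
    Σws≡1 = begin
      sumℚ (map proj₁ (map (map₂ toDecomposition) ws))  ≡⟨ 𝔼-1 (map (map₂ toDecomposition) ws) ⟨
      𝔼 (map (map₂ toDecomposition) ws) (λ _ → 1ℚ)      ≡⟨ 𝔼-map ws toDecomposition (λ _ → 1ℚ) ⟩
      𝔼 ws (λ _ → 1ℚ)                                   ≡⟨ total ⟩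
      1ℚ                                                ∎

    x≡ : ∀ p → x p ≡ combo (map (map₂ toDecomposition) ws) p
    x≡ (a , b , a<b) = sym (begin
      𝔼 (map (map₂ toDecomposition) ws) (λ d → χ d (a , b , a<b))
        ≡⟨ 𝔼-map ws toDecomposition (λ d → χ d (a , b , a<b)) ⟩
      𝔼 ws (λ s → χ (toDecomposition s) (a , b , a<b))
        ≡⟨ 𝔼-cong ws (λ s → χ-decomposition (blockStart-isBlockStart s) a<b) ⟩
      𝔼 ws (λ s → 1ℚ - 𝟙 (blockStart s (toℕ b) ≤? toℕ a))
        ≡⟨ 𝔼-- ws (λ _ → 1ℚ) (λ s → 𝟙 (blockStart s (toℕ b) ≤? toℕ a)) ⟩
      𝔼 ws (λ _ → 1ℚ) - 𝔼 ws (λ s → 𝟙 (blockStart s (toℕ b) ≤? toℕ a))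
        ≡⟨ cong₂ _-_ total (marginal (ℕP.<⇒≤ a<b) (ℕ.s≤s⁻¹ (FinP.toℕ<n b))) ⟩
      1ℚ - (1ℚ - at x (toℕ a) (toℕ b))
        ≡⟨ cancel (at x (toℕ a) (toℕ b)) ⟩
      at x (toℕ a) (toℕ b)
        ≡⟨ at-toℕ x (a , b , a<b) ⟩
      x (a , b , a<b) ∎)
      where
      cancel : ∀ q → 1ℚ - (1ℚ - q) ≡ q
      cancel = solve-∀ ℚ-ring

corollary6p15 : (n : ℕ) → 2 ≤ n → (x : Point n) → InLMC n x ⇔ Ineqs n x
corollary6p15 n 2≤n x = mk⇔ (lmc⇒ineqs x 2≤n) (MarkovConstruction.ineqs⇒lmc x 2≤n)
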